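{- Consider the colorability saturation game with $k=4$ colors on a vertex set $V$ of $n$ vertices. Suppose that at some time $t_i$ Mini has just played the $t_i$-th edge, and that pairwise disjoint sets $V_1,\dots,V_i\subseteq V$ have been designated, each inducing a complete graph in $G(t_i)$. Let $W(i):=V\setminus\bigcup_{j\le i}V_j$ and $\phi(i):=|E_{t_i}[W(i)]|+|E_{t_i}[W(i),V\setminus W(i)]|$. Assume $\phi(i) \le 5$ and $|W(i)| \ge 3$. Then Maxi has a strategy for her subsequent moves such that, against every play of Mini, there exist a time $t_{i+1}$ with $t_i\le t_{i+1} \le t_i+2$ at which Mini plays the $t_{i+1}$-th edge (in particular, the game has not ended before), and a set $V_{i+1}\subseteq W(i)$ with $|V_{i+1}|=2$ inducing an edge in $G(t_{i+1})$, such that, with $W(i+1):=W(i)\setminus V_{i+1}$, we have $\phi(i+1):=|E_{t_{i+1}}[W(i+1)]|+|E_{t_{i+1}}[W(i+1),V\setminus W(i+1)]| \le \max\{\phi(i)-1,1\}$.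
   Context: The colorability saturation game with parameters $k,n$: two players, Maxi and Mini, start with the empty graph on vertex set $V$ with $|V|=n$ and take turns, each turn adding one edge not yet present, subject to the constraint that the current graph stays $k$-colorable; the game ends when the graph is saturated, i.e., no further edge can be added while keeping it $k$-colorable. $G(t)=(V,E_t)$ is the graph after $t$ edges have been played in total. $E_t[A]$ is the set of edges of $G(t)$ with both endpoints in $A$, and $E_t[A,B]$ the set of edges of $G(t)$ with one endpoint in $A$ and the other in $B$. -}

module Defs where

open import Data.Nat using (ℕ; zero; suc; _≤_; _∸_; _⊔_)
open import Data.Nat.Properties using (_≟_)
open import Data.Fin using (Fin)
open import Data.Fin.Subset using (Subset; _∈_; _∉_; _⊆_; ∁; ⋃; _─_; ∣_∣)
open import Data.Fin.Subset.Properties using (_∈?_)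
open import Data.Bool using (Bool; true; false)
open import Data.List using (List; []; _∷_; length; filter; tabulate)
open import Data.List.Membership.Propositional using () renaming (_∈_ to _∈ₗ_)
open import Data.Product using (Σ; _×_; _,_; ∃; ∃-syntax)
open import Data.Sum using (_⊎_)
open import Relation.Nullary using (¬_; Dec; yes; no)
open import Relation.Nullary.Decidable using (_×-dec_; ¬?)
open import Relation.Binary.PropositionalEquality using (_≡_; _≢_)

Edge : ℕ → Set
Edge n = Fin n × Fin n

-- A graph state is the list of edges played so far, MOST RECENT FIRST.
-- (u and v adjacent iff the pair {u,v} occurs, in either orientation.)
Adj : ∀ {n} → List (Edge n) → Fin n → Fin n → Set
Adj h u v = ((u , v) ∈ₗ h) ⊎ ((v , u) ∈ₗ h)

Colorable : ℕ → ∀ {n} → List (Edge n) → Set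
Colorable k {n} h = Σ (Fin n → Fin k) λ c → ∀ u v → Adj h u v → c u ≢ c v

LegalMove : ℕ → ∀ {n} → List (Edge n) → Edge n → Set
LegalMove k h (u , v) = (u ≢ v) × (¬ Adj h u v) × Colorable k ((u , v) ∷ h)

data Play (k : ℕ) {n : ℕ} : List (Edge n) → Set where
  start : Play k []
  move  : ∀ {h e} → Play k h → LegalMove k h e → Play k (e ∷ h)

data Player : Set where
  maxi mini : Player

other : Player → Player
other maxi = mini
other mini = maxi

-- who plays the t-th edge (t ≥ 1), given who plays the first edge
mover : Player → ℕ → Player
mover p zero = other p
mover p (suc zero) = p
mover p (suc (suc t)) = mover p t

Wof : ∀ {n i} → (Fin i → Subset n) → Subset n
Wof V = ∁ (⋃ (tabulate V))

PairwiseDisjoint : ∀ {n i} → (Fin i → Subset n) → Set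
PairwiseDisjoint {n} {i} V = ∀ (j l : Fin i) → j ≢ l → ∀ (x : Fin n) → ¬ (x ∈ V j × x ∈ V l)

Clique : ∀ {n} → List (Edge n) → Subset n → Set
Clique h S = ∀ u v → u ∈ S → v ∈ S → u ≢ v → Adj h u v

inside : ∀ {n} → Subset n → Edge n → Set
inside W (u , v) = u ∈ W × v ∈ W

inside? : ∀ {n} (W : Subset n) (e : Edge n) → Dec (inside W e)
inside? W (u , v) = (u ∈? W) ×-dec (v ∈? W)

crossing : ∀ {n} → Subset n → Edge n → Set
crossing W (u , v) = (u ∈ W × v ∉ W) ⊎ (u ∉ W × v ∈ W)

crossing? : ∀ {n} (W : Subset n) (e : Edge n) → Dec (crossing W e)
crossing? W (u , v) with u ∈? W | v ∈? W
... | yes a | yes b = no λ { (_⊎_.inj₁ (_ , nb)) → nb b ; (_⊎_.inj₂ (na , _)) → na a }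
... | yes a | no b = yes (_⊎_.inj₁ (a , b))
... | no a | yes b = yes (_⊎_.inj₂ (a , b))
... | no a | no b = no λ { (_⊎_.inj₁ (ya , _)) → a ya ; (_⊎_.inj₂ (_ , yb)) → b yb }

-- φ = |E[W]| + |E[W, V∖W]|   (edges of a legal play are pairwise distinct)
φ : ∀ {n} → List (Edge n) → Subset n → ℕ
φ h W = length (filter (inside? W) h) Data.Nat.+ length (filter (crossing? W) h)

Good : ∀ {n} → List (Edge n) → Subset n → ℕ → Set
Good {n} h' W φi = ∃[ S ] (S ⊆ W × ∣ S ∣ ≡ 2 × Clique h' S × φ h' (W ─ S) ≤ ((φi ∸ 1) ⊔ 1))

-- Maxi (to move at graph h, Mini having just played) has a strategy such that
-- against every play of Mini there is t_{i+1} ∈ {t_i, t_i + 2} at which Mini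
-- plays and the target condition holds.  (t_i + 1 is Maxi's move, so these are
-- the only possibilities; a strategy over a horizon of two moves is a choice of
-- Maxi's next edge.)
MaxiAchieves : ℕ → ∀ {n} → List (Edge n) → Subset n → ℕ → Set
MaxiAchieves k h W φi =
  Good h W φi
  ⊎ ∃[ e ] (LegalMove k h e
            × ∃[ f ] LegalMove k (e ∷ h) f
            × (∀ f → LegalMove k (e ∷ h) f → Good (f ∷ e ∷ h) W φi))

-- If W already spans an edge ab, then V_{i+1} = {a, b} works at once: ab is counted by φ(i) but not
-- by φ(i+1). Otherwise every edge meets W at most once, so degrees of vertices of W add up inside φ.
-- Maxi picks u, v ∈ W such that at least two edges, or all edges counted by φ(i), meet {u, v}, plays
-- uv and takes V_{i+1} = {u, v}; as uv misses W ∖ {u, v} and Mini's reply adds at most one edge,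
-- φ(i+1) ≤ max{φ(i) - 1, 1}. With a third w ∈ W, deg u + deg v + deg w ≤ φ(i) ≤ 5, so an endpoint of
-- uv, and later an endpoint of wu or wv, has at most two neighbours; giving it a colour missing
-- from its neighbourhood shows that both moves keep the graph 4-colourable.

module Submission where

open import Defs
open import Data.Nat using (ℕ; suc; _+_; _≤_; _<_; _∸_; _⊔_; z≤n; s≤s; _≤?_)
open import Data.Nat.Properties
open import Data.Fin using (Fin; zero; suc)
import Data.Fin.Properties as Fin
open import Data.Fin.Subset using (Subset; _∈_; _∉_; _⊆_; ⁅_⁆; _∪_; _─_; ∣_∣) renaming (⊥ to ∅)
open import Data.Fin.Subset.Properties
open import Data.List using (List; []; _∷_; length; filter; map)
open import Data.List.Properties using (length-map)
open import Data.List.Relation.Unary.Any using (here; there)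
import Data.List.Relation.Unary.Any as Any
import Data.List.Membership.DecPropositional as DecMembership
open import Data.List.Membership.Setoid.Properties using (index-injective)
open import Data.List.Membership.Propositional using (find; lose) renaming (_∈_ to _∈ₗ_; _∉_ to _∉ₗ_)
open import Data.List.Membership.Propositional.Properties using (∈-map⁺; ∈-filter⁺)
open import Data.Vec using (_∷_)
import Data.Vec as Vec
open import Data.Vec.Functional using (updateAt)
open import Data.Vec.Functional.Properties using (updateAt-updates; updateAt-minimal)
open import Data.Bool using (true)
open import Data.Product using (_×_; _,_; ∃-syntax; ∃₂; proj₁; proj₂)
open import Data.Sum using (_⊎_; inj₁; inj₂)
import Data.Sum as Sum
open import Function using (_∘_; const)
open import Level using (Level)
open import Relation.Nullary using (¬_; yes; no; contradiction)
open import Relation.Nullary.Decidable using (_×-dec_; _⊎-dec_; ¬?)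
open import Relation.Unary using (Pred; Decidable)
open import Relation.Binary.PropositionalEquality
  using (_≡_; _≢_; refl; sym; trans; cong; subst; setoid)

module _ {a p : Level} {A : Set a} where

  count : {P : Pred A p} → Decidable P → List A → ℕ
  count P? xs = length (filter P? xs)

  count-∷-≤ : {P : Pred A p} (P? : Decidable P) (x : A) (xs : List A)
    → count P? (x ∷ xs) ≤ suc (count P? xs)
  count-∷-≤ P? x xs with P? x
  ... | yes _ = ≤-refl
  ... | no _ = n≤1+n _

  count-∷-¬ : {P : Pred A p} (P? : Decidable P) {x : A} (xs : List A)
    → ¬ P x → count P? (x ∷ xs) ≡ count P? xs
  count-∷-¬ P? {x} xs ¬px with P? x
  ... | yes px = contradiction px ¬px
  ... | no _ = refl

  count-≥1 : {P : Pred A p} (P? : Decidable P) {x : A} {xs : List A} → x ∈ₗ xs → P x → 1 ≤ count P? xs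
  count-≥1 P? {xs = y ∷ xs} x∈ px with P? y | x∈
  ... | yes _ | _ = s≤s z≤n
  ... | no ¬py | here refl = contradiction px ¬py
  ... | no _ | there x∈xs = count-≥1 P? x∈xs px

  count-mono : {P Q : Pred A p} (P? : Decidable P) (Q? : Decidable Q) (xs : List A)
    → (∀ {x} → x ∈ₗ xs → P x → Q x) → count P? xs ≤ count Q? xs
  count-mono P? Q? [] _ = z≤n
  count-mono P? Q? (x ∷ xs) P⇒Q with P? x | Q? x | count-mono P? Q? xs (P⇒Q ∘ there)
  ... | yes px | no ¬qx | _ = contradiction (P⇒Q (here refl) px) ¬qx
  ... | yes _ | yes _ | ih = s≤s ih
  ... | no _ | yes _ | ih = m≤n⇒m≤1+n ih
  ... | no _ | no _ | ih = ih

  count-< : {P Q : Pred A p} (P? : Decidable P) (Q? : Decidable Q) {x : A} {xs : List A}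
    → (∀ {y} → y ∈ₗ xs → P y → Q y) → x ∈ₗ xs → Q x → ¬ P x → count P? xs < count Q? xs
  count-< P? Q? {xs = y ∷ xs} P⇒Q x∈ qx ¬px
    with P? y | Q? y | x∈
  ... | yes py | no ¬qy | _ = contradiction (P⇒Q (here refl) py) ¬qy
  ... | yes _ | yes _ | there x∈xs = s≤s (count-< P? Q? (P⇒Q ∘ there) x∈xs qx ¬px)
  ... | yes py | yes _ | here refl = contradiction py ¬px
  ... | no _ | yes _ | here refl = s≤s (count-mono P? Q? xs (P⇒Q ∘ there))
  ... | no _ | yes _ | there x∈xs = m≤n⇒m≤1+n (count-< P? Q? (P⇒Q ∘ there) x∈xs qx ¬px)
  ... | no _ | no ¬qy | here refl = contradiction qx ¬qy
  ... | no _ | no _ | there x∈xs = count-< P? Q? (P⇒Q ∘ there) x∈xs qx ¬px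

  count-disjoint-+-≤ : {P Q R : Pred A p}
    (P? : Decidable P) (Q? : Decidable Q) (R? : Decidable R) (xs : List A)
    → (∀ {x} → x ∈ₗ xs → P x → Q x) → (∀ {x} → x ∈ₗ xs → R x → Q x)
    → (∀ {x} → x ∈ₗ xs → P x → ¬ R x)
    → count P? xs + count R? xs ≤ count Q? xs
  count-disjoint-+-≤ P? Q? R? [] _ _ _ = z≤n
  count-disjoint-+-≤ P? Q? R? (x ∷ xs) P⇒Q R⇒Q P⇒¬R
    with P? x | R? x | Q? x | count-disjoint-+-≤ P? Q? R? xs (P⇒Q ∘ there) (R⇒Q ∘ there) (P⇒¬R ∘ there)
  ... | yes px | yes rx | _ | _ = contradiction rx (P⇒¬R (here refl) px)
  ... | yes px | no _ | no ¬qx | _ = contradiction (P⇒Q (here refl) px) ¬qx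
  ... | no _ | yes rx | no ¬qx | _ = contradiction (R⇒Q (here refl) rx) ¬qx
  ... | yes _ | no _ | yes _ | ih = s≤s ih
  ... | no _ | yes _ | yes _ | ih =
    subst (_≤ suc (count Q? xs)) (sym (+-suc (count P? xs) (count R? xs))) (s≤s ih)
  ... | no _ | no _ | yes _ | ih = m≤n⇒m≤1+n ih
  ... | no _ | no _ | no _ | ih = ih

+≤suc+⇒≤⊎≤ : ∀ a b m n → a + b ≤ suc (m + n) → a ≤ m ⊎ b ≤ n
+≤suc+⇒≤⊎≤ a b m n a+b≤ with a ≤? m
... | yes a≤m = inj₁ a≤m
... | no a≰m = inj₂ (+-cancelˡ-≤ (suc m) b n (≤-trans (+-monoˡ-≤ b (≰⇒> a≰m)) a+b≤))

<⇒≤pred⊔1 : ∀ {p q} → p < q → p ≤ (q ∸ 1) ⊔ 1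
<⇒≤pred⊔1 {q = suc q} (s≤s p≤q) = m≤n⇒m≤n⊔o 1 p≤q

+≤⇒<pred⊔1 : ∀ {p t q} → p + t ≤ q → 2 ≤ t ⊎ q ≤ t → p < (q ∸ 1) ⊔ 1
+≤⇒<pred⊔1 {p} {t} p+t≤q (inj₁ 2≤t) =
  <⇒≤pred⊔1 (≤-trans (≤-reflexive (+-comm 2 p)) (≤-trans (+-monoʳ-≤ p 2≤t) p+t≤q))
+≤⇒<pred⊔1 {p} {t} {q} p+t≤q (inj₂ q≤t) =
  ≤-trans (s≤s (+-cancelʳ-≤ t p 0 (≤-trans p+t≤q q≤t))) (m≤n⊔m (q ∸ 1) 1)

x∈p─q⇒x∉q : ∀ {n} {x : Fin n} (p q : Subset n) → x ∈ p ─ q → x ∉ q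
x∈p─q⇒x∉q (_ ∷ p) (_ ∷ q) (Vec.there x∈) (Vec.there x∈q) = x∈p─q⇒x∉q p q x∈ x∈q
x∈p─q⇒x∉q (_ ∷ p) (true ∷ q) () Vec.here

module _ {n : ℕ} where

  ∣q∣<∣p∣⇒∃∈p∉q : ∀ {p q : Subset n} → ∣ q ∣ < ∣ p ∣ → ∃[ x ] (x ∈ p × x ∉ q)
  ∣q∣<∣p∣⇒∃∈p∉q {p} {q} ∣q∣<∣p∣ with Fin.any? (λ x → (x ∈? p) ×-dec ¬? (x ∈? q))
  ... | yes found = found
  ... | no none = contradiction (p⊆q⇒∣p∣≤∣q∣ p⊆q) (<⇒≱ ∣q∣<∣p∣)
    where
    p⊆q : p ⊆ q
    p⊆q {x} x∈p with x ∈? q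
    ... | yes x∈q = x∈q
    ... | no x∉q = contradiction (x , x∈p , x∉q) none

  pair : Fin n → Fin n → Subset n
  pair a b = ⁅ a ⁆ ∪ ⁅ b ⁆

  ∈pair⁻ : ∀ {a b x : Fin n} → x ∈ pair a b → x ≡ a ⊎ x ≡ b
  ∈pair⁻ {a} {b} = Sum.map (x∈⁅y⁆⇒x≡y a) (x∈⁅y⁆⇒x≡y b) ∘ x∈p∪q⁻ ⁅ a ⁆ ⁅ b ⁆

  a∈pair : ∀ (a b : Fin n) → a ∈ pair a b
  a∈pair a b = p⊆p∪q ⁅ b ⁆ (x∈⁅x⁆ a)

  b∈pair : ∀ (a b : Fin n) → b ∈ pair a b
  b∈pair a b = q⊆p∪q ⁅ a ⁆ ⁅ b ⁆ (x∈⁅x⁆ b)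

  pair⊆ : ∀ {a b : Fin n} {W : Subset n} → a ∈ W → b ∈ W → pair a b ⊆ W
  pair⊆ a∈W b∈W x∈ with ∈pair⁻ x∈
  ... | inj₁ refl = a∈W
  ... | inj₂ refl = b∈W

∣pair∣≤2 : ∀ {n} (a b : Fin n) → ∣ pair a b ∣ ≤ 2
∣pair∣≤2 {suc n} zero zero rewrite ∪-idem (∅ {n}) | ∣⊥∣≡0 n = s≤s z≤n
∣pair∣≤2 zero (suc b) rewrite ∪-identityˡ ⁅ b ⁆ | ∣⁅x⁆∣≡1 b = ≤-refl
∣pair∣≤2 (suc a) zero rewrite ∪-identityʳ ⁅ a ⁆ | ∣⁅x⁆∣≡1 a = ≤-refl
∣pair∣≤2 (suc a) (suc b) = ∣pair∣≤2 a b

∣pair∣≡2 : ∀ {n} {a b : Fin n} → a ≢ b → ∣ pair a b ∣ ≡ 2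
∣pair∣≡2 {a = zero} {zero} a≢b = contradiction refl a≢b
∣pair∣≡2 {a = zero} {suc b} _ rewrite ∪-identityˡ ⁅ b ⁆ | ∣⁅x⁆∣≡1 b = refl
∣pair∣≡2 {a = suc a} {zero} _ rewrite ∪-identityʳ ⁅ a ⁆ | ∣⁅x⁆∣≡1 a = refl
∣pair∣≡2 {a = suc a} {suc b} a≢b = ∣pair∣≡2 (a≢b ∘ cong suc)

module _ {n : ℕ} where

  Touches : Subset n → Edge n → Set
  Touches S (a , b) = a ∈ S ⊎ b ∈ S

  touches? : (S : Subset n) → Decidable (Touches S)
  touches? S (a , b) = (a ∈? S) ⊎-dec (b ∈? S)

  touches-mono : ∀ {S T : Subset n} {e : Edge n} → S ⊆ T → Touches S e → Touches T e
  touches-mono S⊆T = Sum.map S⊆T S⊆T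

  touches-split : ∀ (W S : Subset n) {e : Edge n} → Touches W e → Touches (W ─ S) e ⊎ Touches S e
  touches-split W S {a , b} (inj₁ a∈W) with a ∈? S
  ... | yes a∈S = inj₂ (inj₁ a∈S)
  ... | no a∉S = inj₁ (inj₁ (x∈p∧x∉q⇒x∈p─q a∈W a∉S))
  touches-split W S {a , b} (inj₂ b∈W) with b ∈? S
  ... | yes b∈S = inj₂ (inj₂ b∈S)
  ... | no b∉S = inj₁ (inj₂ (x∈p∧x∉q⇒x∈p─q b∈W b∉S))

  ¬touches-─-pair : ∀ (W : Subset n) (a b : Fin n) → ¬ Touches (W ─ pair a b) (a , b)
  ¬touches-─-pair W a b (inj₁ a∈) = x∈p─q⇒x∉q W (pair a b) a∈ (a∈pair a b)
  ¬touches-─-pair W a b (inj₂ b∈) = x∈p─q⇒x∉q W (pair a b) b∈ (b∈pair a b)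

  φ≡count-touches : ∀ (h : List (Edge n)) (W : Subset n) → φ h W ≡ count (touches? W) h
  φ≡count-touches [] W = refl
  φ≡count-touches ((a , b) ∷ h) W with a ∈? W | b ∈? W | φ≡count-touches h W
  ... | yes _ | yes _ | ih = cong suc ih
  ... | yes _ | no _ | ih = trans (+-suc _ _) (cong suc ih)
  ... | no _ | yes _ | ih = trans (+-suc _ _) (cong suc ih)
  ... | no _ | no _ | ih = ih

  NoEdgeInside : Subset n → List (Edge n) → Set
  NoEdgeInside W h = ∀ {e} → e ∈ₗ h → ¬ inside W e

  noEdgeInside-⊆ : ∀ {S W : Subset n} {h : List (Edge n)} → S ⊆ W → NoEdgeInside W h → NoEdgeInside S h
  noEdgeInside-⊆ S⊆W noIn e∈h (a∈S , b∈S) = noIn e∈h (S⊆W a∈S , S⊆W b∈S)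

  -- Without edges inside C, an edge touches at most one vertex of C.
  touches-disjoint-+-≤ : ∀ {A B C : Subset n} {h : List (Edge n)} → NoEdgeInside C h
    → A ⊆ C → B ⊆ C → (∀ {x} → x ∈ A → x ∉ B)
    → count (touches? A) h + count (touches? B) h ≤ count (touches? C) h
  touches-disjoint-+-≤ {A} {B} {C} {h} noIn A⊆C B⊆C A∩B=∅ =
    count-disjoint-+-≤ (touches? A) (touches? C) (touches? B) h
      (λ _ → touches-mono A⊆C) (λ _ → touches-mono B⊆C) exclusive
    where
    exclusive : ∀ {e} → e ∈ₗ h → Touches A e → ¬ Touches B e
    exclusive _ (inj₁ a∈A) (inj₁ a∈B) = A∩B=∅ a∈A a∈B
    exclusive _ (inj₂ b∈A) (inj₂ b∈B) = A∩B=∅ b∈A b∈B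
    exclusive e∈h (inj₁ a∈A) (inj₂ b∈B) = noIn e∈h (A⊆C a∈A , B⊆C b∈B)
    exclusive e∈h (inj₂ b∈A) (inj₁ a∈B) = noIn e∈h (B⊆C a∈B , A⊆C b∈A)

  degree : Fin n → List (Edge n) → ℕ
  degree x = count (touches? ⁅ x ⁆)

  otherEnd : Fin n → Edge n → Fin n
  otherEnd x (a , b) with a Fin.≟ x
  ... | yes _ = b
  ... | no _ = a

  neighbours : Fin n → List (Edge n) → List (Fin n)
  neighbours x h = map (otherEnd x) (filter (touches? ⁅ x ⁆) h)

  length-neighbours : ∀ (x : Fin n) (h : List (Edge n)) → length (neighbours x h) ≡ degree x h
  length-neighbours x h = length-map (otherEnd x) (filter (touches? ⁅ x ⁆) h)

  adj⇒∈neighbours : ∀ {h : List (Edge n)} {x z : Fin n} → Adj h x z → z ∈ₗ neighbours x h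
  adj⇒∈neighbours {h = h} {x} {z} (inj₁ xz∈h) =
    subst (_∈ₗ neighbours x h) (otherEnd-left x z)
      (∈-map⁺ (otherEnd x) (∈-filter⁺ (touches? ⁅ x ⁆) xz∈h (inj₁ (x∈⁅x⁆ x))))
    where
    otherEnd-left : ∀ x z → otherEnd x (x , z) ≡ z
    otherEnd-left x z with x Fin.≟ x
    ... | yes _ = refl
    ... | no x≢x = contradiction refl x≢x
  adj⇒∈neighbours {h = h} {x} {z} (inj₂ zx∈h) =
    subst (_∈ₗ neighbours x h) (otherEnd-right x z)
      (∈-map⁺ (otherEnd x) (∈-filter⁺ (touches? ⁅ x ⁆) zx∈h (inj₂ (x∈⁅x⁆ x))))
    where
    otherEnd-right : ∀ x z → otherEnd x (z , x) ≡ z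
    otherEnd-right x z with z Fin.≟ x
    ... | yes z≡x = sym z≡x
    ... | no _ = refl

  adj-sym : ∀ {h : List (Edge n)} {x y : Fin n} → Adj h x y → Adj h y x
  adj-sym = Sum.swap

  pair-clique : ∀ {h : List (Edge n)} {a b : Fin n} → Adj h a b → Clique h (pair a b)
  pair-clique adj x y x∈ y∈ x≢y with ∈pair⁻ x∈ | ∈pair⁻ y∈
  ... | inj₁ refl | inj₂ refl = adj
  ... | inj₂ refl | inj₁ refl = adj-sym adj
  ... | inj₁ refl | inj₁ refl = contradiction refl x≢y
  ... | inj₂ refl | inj₂ refl = contradiction refl x≢y

missing-colour : ∀ {k} (L : List (Fin k)) → length L < k → ∃[ d ] d ∉ₗ L
missing-colour {k} L ∣L∣<k = Fin.¬∀⟶∃¬ k (_∈ₗ L) (λ d → DecMembership._∈?_ Fin._≟_ d L) not-all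
  where
  not-all : ¬ (∀ d → d ∈ₗ L)
  not-all all∈ = <⇒≱ ∣L∣<k (Fin.injective⇒≤ λ {d} {d′} →
    index-injective (setoid (Fin k)) (all∈ d) (all∈ d′))

module _ {k n : ℕ} where

  no-loop : ∀ {h : List (Edge n)} → Colorable k h → ∀ x → ¬ Adj h x x
  no-loop (c , proper) x adj = proper x x adj refl

  colorable-resp : ∀ {h h′ : List (Edge n)} → (∀ {u v} → Adj h′ u v → Adj h u v)
    → Colorable k h → Colorable k h′
  colorable-resp h′⊆h (c , proper) = c , λ u v → proper u v ∘ h′⊆h

  colorable-flip : ∀ {h : List (Edge n)} {x y : Fin n}
    → Colorable k ((x , y) ∷ h) → Colorable k ((y , x) ∷ h)
  colorable-flip = colorable-resp λ where
    (inj₁ (here refl)) → inj₂ (here refl)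
    (inj₂ (here refl)) → inj₁ (here refl)
    (inj₁ (there uv∈h)) → inj₁ (there uv∈h)
    (inj₂ (there vu∈h)) → inj₂ (there vu∈h)

  module _ {h : List (Edge n)} {x y : Fin n} {c : Fin n → Fin k} {d : Fin k}
           (proper : ∀ u v → Adj h u v → c u ≢ c v) (x≢y : x ≢ y)
           (d∉ : d ∉ₗ c y ∷ map c (neighbours x h)) where

    neighbour-colour : ∀ {z} → Adj h x z → d ≡ c z → d ∈ₗ map c (neighbours x h)
    neighbour-colour adj d≡cz =
      subst (_∈ₗ map c (neighbours x h)) (sym d≡cz) (∈-map⁺ c (adj⇒∈neighbours adj))

    fresh-colour : ∀ {z} → z ≢ x → Adj ((x , y) ∷ h) x z → d ≢ c z
    fresh-colour _ (inj₁ (here refl)) = d∉ ∘ here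
    fresh-colour z≢x (inj₂ (here refl)) = contradiction refl z≢x
    fresh-colour _ (inj₁ (there xz∈h)) = d∉ ∘ there ∘ neighbour-colour (inj₁ xz∈h)
    fresh-colour _ (inj₂ (there zx∈h)) = d∉ ∘ there ∘ neighbour-colour (inj₂ zx∈h)

    recoloured-at : ∀ {z} → Adj ((x , y) ∷ h) x z
      → updateAt c x (const d) x ≢ updateAt c x (const d) z
    recoloured-at {z} adj with z Fin.≟ x | adj
    ... | yes refl | inj₁ (here refl) = contradiction refl x≢y
    ... | yes refl | inj₂ (here refl) = contradiction refl x≢y
    ... | yes refl | inj₁ (there xx∈h) = contradiction refl (proper x x (inj₁ xx∈h))
    ... | yes refl | inj₂ (there xx∈h) = contradiction refl (proper x x (inj₂ xx∈h))
    ... | no z≢x | _ = λ eq →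
      fresh-colour z≢x adj (trans (sym (updateAt-updates x c)) (trans eq (updateAt-minimal z x c z≢x)))

    recoloured-proper : ∀ u v → Adj ((x , y) ∷ h) u v
      → updateAt c x (const d) u ≢ updateAt c x (const d) v
    recoloured-proper u v adj with u Fin.≟ x | v Fin.≟ x
    ... | yes refl | _ = recoloured-at adj
    ... | no _ | yes refl = recoloured-at (adj-sym adj) ∘ sym
    ... | no u≢x | no v≢x = λ eq →
      proper u v (old adj)
        (trans (sym (updateAt-minimal u x c u≢x)) (trans eq (updateAt-minimal v x c v≢x)))
      where
      old : Adj ((x , y) ∷ h) u v → Adj h u v
      old (inj₁ (here refl)) = contradiction refl u≢x
      old (inj₂ (here refl)) = contradiction refl v≢x
      old (inj₁ (there uv∈h)) = inj₁ uv∈h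
      old (inj₂ (there vu∈h)) = inj₂ vu∈h

  extend-colouring : ∀ {h : List (Edge n)} {x y : Fin n} → Colorable k h → x ≢ y → 2 + degree x h ≤ k
    → Colorable k ((x , y) ∷ h)
  extend-colouring {h} {x} {y} (c , proper) x≢y 2+deg≤k =
    let d , d∉ = missing-colour (c y ∷ map c (neighbours x h)) short
    in updateAt c x (const d) , recoloured-proper proper x≢y d∉
    where
    short : length (c y ∷ map c (neighbours x h)) < k
    short = subst (λ m → 2 + m ≤ k)
      (sym (trans (length-map c (neighbours x h)) (length-neighbours x h))) 2+deg≤k

  extend-colouring-either : ∀ {h : List (Edge n)} {x y : Fin n} → Colorable k h → x ≢ y
    → 2 + degree x h ≤ k ⊎ 2 + degree y h ≤ k → Colorable k ((x , y) ∷ h)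
  extend-colouring-either col x≢y (inj₁ low-x) = extend-colouring col x≢y low-x
  extend-colouring-either col x≢y (inj₂ low-y) = colorable-flip (extend-colouring col (x≢y ∘ sym) low-y)

play-colorable : ∀ {k n} {h : List (Edge n)} → Play (suc k) h → Colorable (suc k) h
play-colorable start = const zero , λ { _ _ (inj₁ ()) ; _ _ (inj₂ ()) }
play-colorable (move _ (_ , _ , col)) = col

module _ {n : ℕ} where

  singletons-disjoint : ∀ {a b x : Fin n} → a ≢ b → x ∈ ⁅ a ⁆ → x ∉ ⁅ b ⁆
  singletons-disjoint {a} {b} a≢b x∈a x∈b = a≢b (trans (sym (x∈⁅y⁆⇒x≡y a x∈a)) (x∈⁅y⁆⇒x≡y b x∈b))

  ∉pair⇒≢ : ∀ {a b x : Fin n} → x ∉ pair a b → x ≢ a × x ≢ b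
  ∉pair⇒≢ {a} {b} x∉ = (λ { refl → x∉ (a∈pair a b) }) , (λ { refl → x∉ (b∈pair a b) })

  touches⇒∃endpoint : ∀ {S : Subset n} {e : Edge n} → Touches S e → ∃[ x ] (x ∈ S × Touches ⁅ x ⁆ e)
  touches⇒∃endpoint {e = a , _} (inj₁ a∈S) = a , a∈S , inj₁ (x∈⁅x⁆ a)
  touches⇒∃endpoint {e = _ , b} (inj₂ b∈S) = b , b∈S , inj₂ (x∈⁅x⁆ b)

  pair-good : ∀ {h : List (Edge n)} {W : Subset n} {φi : ℕ} {a b : Fin n} → a ∈ W → b ∈ W → a ≢ b
    → Adj h a b → φ h (W ─ pair a b) ≤ (φi ∸ 1) ⊔ 1 → Good h W φi
  pair-good a∈W b∈W a≢b adj bound = _ , pair⊆ a∈W b∈W , ∣pair∣≡2 a≢b , pair-clique adj , bound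

  edge-inside-good : ∀ {k} {h : List (Edge n)} {W : Subset n} {a b : Fin n} → Colorable k h
    → (a , b) ∈ₗ h → a ∈ W → b ∈ W → Good h W (φ h W)
  edge-inside-good {h = h} {W} {a} {b} col ab∈h a∈W b∈W =
    pair-good {φi = φ h W} a∈W b∈W (λ { refl → no-loop col a (inj₁ ab∈h) }) (inj₁ ab∈h)
      (<⇒≤pred⊔1 φ-drops)
    where
    open ≤-Reasoning
    φ-drops : φ h (W ─ pair a b) < φ h W
    φ-drops = begin-strict
      φ h (W ─ pair a b)                  ≡⟨ φ≡count-touches h (W ─ pair a b) ⟩
      count (touches? (W ─ pair a b)) h   <⟨ count-< (touches? (W ─ pair a b)) (touches? W)
                                               (λ _ → touches-mono (p─q⊆p W (pair a b)))
                                               ab∈h (inj₁ a∈W) (¬touches-─-pair W a b) ⟩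
      count (touches? W) h                ≡⟨ φ≡count-touches h W ⟨
      φ h W                               ∎

  HeavyPair : List (Edge n) → Subset n → Fin n → Fin n → Set
  HeavyPair h W u v = u ∈ W × v ∈ W × u ≢ v
    × (2 ≤ count (touches? (pair u v)) h ⊎ φ h W ≤ count (touches? (pair u v)) h)

  centred-heavy-pair : ∀ {h : List (Edge n)} {W : Subset n} {p : Fin n} → 3 ≤ ∣ W ∣ → p ∈ W
    → (∀ {e} → e ∈ₗ h → ¬ Touches (W ─ ⁅ p ⁆) e) → ∃[ v ] HeavyPair h W p v
  centred-heavy-pair {h} {W} {p} 3≤∣W∣ p∈W untouched
    with v , v∈W , v∉p ← ∣q∣<∣p∣⇒∃∈p∉q (subst (_< ∣ W ∣) (sym (∣⁅x⁆∣≡1 p)) (m+n≤o⇒n≤o 1 3≤∣W∣)) =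
    v , p∈W , v∈W , x∉⁅y⁆⇒x≢y v∉p ∘ sym , inj₂ all-at-pair
    where
    at-pair : ∀ {v e} → e ∈ₗ h → Touches W e → Touches (pair p v) e
    at-pair {v} e∈h e-touches with touches-split W ⁅ p ⁆ e-touches
    ... | inj₁ elsewhere = contradiction elsewhere (untouched e∈h)
    ... | inj₂ at-p = touches-mono (p⊆p∪q ⁅ v ⁆) at-p
    all-at-pair : ∀ {v} → φ h W ≤ count (touches? (pair p v)) h
    all-at-pair {v} = subst (_≤ count (touches? (pair p v)) h) (sym (φ≡count-touches h W))
      (count-mono (touches? W) (touches? (pair p v)) h at-pair)

  heavy-pair : ∀ {h : List (Edge n)} {W : Subset n} → NoEdgeInside W h → 3 ≤ ∣ W ∣ → ∃₂ (HeavyPair h W)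
  heavy-pair {h} {W} noIn 3≤∣W∣ with Any.any? (touches? W) h
  ... | no untouched =
    let p , p∈W , _ = ∣q∣<∣p∣⇒∃∈p∉q {q = ∅} (subst (_< ∣ W ∣) (sym (∣⊥∣≡0 n)) (m+n≤o⇒n≤o 2 3≤∣W∣))
    in p , centred-heavy-pair 3≤∣W∣ p∈W (λ e∈h → untouched ∘ lose e∈h ∘ touches-mono (p─q⊆p W ⁅ p ⁆))
  ... | yes touched
    with e , e∈h , e-touches ← find touched
    with p , p∈W , e-at-p ← touches⇒∃endpoint e-touches
    with Any.any? (touches? (W ─ ⁅ p ⁆)) h
  ... | no untouched = p , centred-heavy-pair 3≤∣W∣ p∈W (λ e∈h → untouched ∘ lose e∈h)
  ... | yes touched′
    with e′ , e′∈h , e′-touches ← find touched′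
    with q , q∈W─p , e′-at-q ← touches⇒∃endpoint e′-touches =
    p , q , p∈W , q∈W , p≢q , inj₁ (≤-trans one+one (touches-disjoint-+-≤ noIn-pq
      (p⊆p∪q ⁅ q ⁆) (q⊆p∪q ⁅ p ⁆ ⁅ q ⁆) (singletons-disjoint p≢q)))
    where
    q∈W : q ∈ W
    q∈W = p─q⊆p W ⁅ p ⁆ q∈W─p
    p≢q : p ≢ q
    p≢q = x∉⁅y⁆⇒x≢y (x∈p─q⇒x∉q W ⁅ p ⁆ q∈W─p) ∘ sym
    noIn-pq : NoEdgeInside (pair p q) h
    noIn-pq = noEdgeInside-⊆ (pair⊆ p∈W q∈W) noIn
    one+one : 2 ≤ degree p h + degree q h
    one+one = +-mono-≤ (count-≥1 (touches? ⁅ p ⁆) e∈h e-at-p) (count-≥1 (touches? ⁅ q ⁆) e′∈h e′-at-q)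

module PairStrategy {n : ℕ} {h : List (Edge n)} {W : Subset n} (col : Colorable 4 h)
  (noIn : NoEdgeInside W h) (φ≤5 : φ h W ≤ 5) {u v w : Fin n} (u∈W : u ∈ W) (v∈W : v ∈ W) (u≢v : u ≢ v)
  (heavy : 2 ≤ count (touches? (pair u v)) h ⊎ φ h W ≤ count (touches? (pair u v)) h)
  (w∈W : w ∈ W) (w∉uv : w ∉ pair u v) where

  open ≤-Reasoning

  S : Subset n
  S = pair u v

  S⊆W : S ⊆ W
  S⊆W = pair⊆ u∈W v∈W

  w≢u : w ≢ u
  w≢u = proj₁ (∉pair⇒≢ w∉uv)

  w≢v : w ≢ v
  w≢v = proj₂ (∉pair⇒≢ w∉uv)

  degrees≤5 : degree u h + degree v h + degree w h ≤ 5
  degrees≤5 = begin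
    degree u h + degree v h + degree w h
      ≤⟨ +-monoˡ-≤ (degree w h) (touches-disjoint-+-≤ (noEdgeInside-⊆ S⊆W noIn)
           (p⊆p∪q ⁅ v ⁆) (q⊆p∪q ⁅ u ⁆ ⁅ v ⁆) (singletons-disjoint u≢v)) ⟩
    count (touches? S) h + degree w h
      ≤⟨ touches-disjoint-+-≤ noIn S⊆W (λ x∈w → subst (_∈ W) (sym (x∈⁅y⁆⇒x≡y w x∈w)) w∈W)
           (λ x∈S x∈w → w∉uv (subst (_∈ S) (x∈⁅y⁆⇒x≡y w x∈w) x∈S)) ⟩
    count (touches? W) h
      ≡⟨ φ≡count-touches h W ⟨
    φ h W
      ≤⟨ φ≤5 ⟩
    5 ∎

  maxi-move : LegalMove 4 h (u , v)
  maxi-move = u≢v , (λ { (inj₁ uv∈h) → noIn uv∈h (u∈W , v∈W) ; (inj₂ vu∈h) → noIn vu∈h (v∈W , u∈W) })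
    , extend-colouring-either col u≢v (Sum.map (+-monoʳ-≤ 2) (+-monoʳ-≤ 2)
        (+≤suc+⇒≤⊎≤ (degree u h) (degree v h) 2 2 (m+n≤o⇒m≤o _ degrees≤5)))

  h₁ : List (Edge n)
  h₁ = (u , v) ∷ h

  col₁ : Colorable 4 h₁
  col₁ = proj₂ (proj₂ maxi-move)

  ¬adj-w : ∀ {y} → y ∈ W → ¬ Adj h₁ w y
  ¬adj-w _ (inj₁ (here wy≡uv)) = w≢u (cong proj₁ wy≡uv)
  ¬adj-w _ (inj₂ (here yw≡uv)) = w≢v (cong proj₂ yw≡uv)
  ¬adj-w y∈W (inj₁ (there wy∈h)) = noIn wy∈h (w∈W , y∈W)
  ¬adj-w y∈W (inj₂ (there yw∈h)) = noIn yw∈h (y∈W , w∈W)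

  low-after-maxi : ∀ {x} → degree x h ≤ 1 → 2 + degree x h₁ ≤ 4
  low-after-maxi {x} deg≤1 = +-monoʳ-≤ 2 (≤-trans (count-∷-≤ (touches? ⁅ x ⁆) (u , v) h) (s≤s deg≤1))

  degree-w-unchanged : degree w h₁ ≡ degree w h
  degree-w-unchanged = count-∷-¬ (touches? ⁅ w ⁆) h
    λ { (inj₁ u∈w) → w≢u (sym (x∈⁅y⁆⇒x≡y w u∈w)) ; (inj₂ v∈w) → w≢v (sym (x∈⁅y⁆⇒x≡y w v∈w)) }

  mini-move : ∃[ f ] LegalMove 4 h₁ f
  mini-move with +≤suc+⇒≤⊎≤ (degree u h + degree v h) (degree w h) 2 2 degrees≤5
  ... | inj₂ dw≤2 = (w , u) , w≢u , ¬adj-w u∈W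
    , extend-colouring col₁ w≢u (+-monoʳ-≤ 2 (subst (_≤ 2) (sym degree-w-unchanged) dw≤2))
  ... | inj₁ du+dv≤2 with +≤suc+⇒≤⊎≤ (degree u h) (degree v h) 1 0 du+dv≤2
  ...   | inj₁ du≤1 = (w , u) , w≢u , ¬adj-w u∈W
    , colorable-flip (extend-colouring col₁ (w≢u ∘ sym) (low-after-maxi du≤1))
  ...   | inj₂ dv≤0 = (w , v) , w≢v , ¬adj-w v∈W
    , colorable-flip (extend-colouring col₁ (w≢v ∘ sym) (low-after-maxi (m≤n⇒m≤1+n dv≤0)))

  good-after : ∀ f → Good (f ∷ h₁) W (φ h W)
  good-after f = pair-good {φi = φ h W} u∈W v∈W u≢v (inj₁ (there (here refl))) (begin
    φ (f ∷ h₁) (W ─ S)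
      ≡⟨ φ≡count-touches (f ∷ h₁) (W ─ S) ⟩
    count (touches? (W ─ S)) (f ∷ h₁)
      ≤⟨ count-∷-≤ (touches? (W ─ S)) f h₁ ⟩
    suc (count (touches? (W ─ S)) h₁)
      ≡⟨ cong suc (count-∷-¬ (touches? (W ─ S)) h (¬touches-─-pair W u v)) ⟩
    suc (count (touches? (W ─ S)) h)
      ≤⟨ +≤⇒<pred⊔1 removal heavy ⟩
    (φ h W ∸ 1) ⊔ 1 ∎)
    where
    removal : count (touches? (W ─ S)) h + count (touches? S) h ≤ φ h W
    removal = subst (count (touches? (W ─ S)) h + count (touches? S) h ≤_) (sym (φ≡count-touches h W))
      (touches-disjoint-+-≤ noIn (p─q⊆p W S) S⊆W (x∈p─q⇒x∉q W S))

  maxi-achieves : MaxiAchieves 4 h W (φ h W)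
  maxi-achieves = inj₂ ((u , v) , maxi-move , proj₁ mini-move , proj₂ mini-move , λ f _ → good-after f)

maxi-achieves : ∀ {n} {h : List (Edge n)} {W : Subset n} → Colorable 4 h → φ h W ≤ 5 → 3 ≤ ∣ W ∣
  → MaxiAchieves 4 h W (φ h W)
maxi-achieves {h = h} {W} col φ≤5 3≤∣W∣ with Any.any? (inside? W) h
... | yes inside with (a , b) , ab∈h , a∈W , b∈W ← find inside =
  inj₁ (edge-inside-good col ab∈h a∈W b∈W)
... | no none = pair-case (λ e∈h → none ∘ lose e∈h)
  where
  pair-case : NoEdgeInside W h → MaxiAchieves 4 h W (φ h W)
  pair-case noIn
    with u , v , u∈W , v∈W , u≢v , heavy ← heavy-pair noIn 3≤∣W∣
    with w , w∈W , w∉uv ← ∣q∣<∣p∣⇒∃∈p∉q (≤-<-trans (∣pair∣≤2 u v) 3≤∣W∣) =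
    PairStrategy.maxi-achieves col noIn φ≤5 u∈W v∈W u≢v heavy w∈W w∉uv

-- Only the 4-colourability of G(t_i) is used.
lemma5p3 : (first : Player) (n : ℕ) (h : List (Edge n)) → Play 4 h
    → 1 ≤ length h → mover first (length h) ≡ mini
    → (i : ℕ) (V : Fin i → Subset n) → PairwiseDisjoint V
    → (∀ j → Clique h (V j))
    → φ h (Wof V) ≤ 5 → 3 ≤ ∣ Wof V ∣
    → MaxiAchieves 4 h (Wof V) (φ h (Wof V))
lemma5p3 _ _ _ play _ _ _ _ _ _ φ≤5 3≤∣W∣ = maxi-achieves (play-colorable play) φ≤5 3≤∣W∣
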